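{- Let $k>0$ be an integer and let $G^c$ be a vertex-coloured graph with $n$ vertices, $m$ edges and $c$ colours. If $m\ge \binom{n-k+c-1}{2}+n-k$ and $n>k+c-2$, then $\gamma^t(G^c)\le k$. Furthermore, there are vertex-coloured graphs with that number of edges (i.e. $m=\binom{n-k+c-1}{2}+n-k$) and $\gamma^t=k$.
   Context: A vertex-coloured graph $G^c$ is a finite simple undirected graph in which each vertex receives exactly one colour from $\{1,\dots,c\}$ and every colour is used at least once. A tropical dominating set is a set $S$ of vertices such that every vertex is in $S$ or adjacent to a vertex of $S$, and every colour appears on some vertex of $S$; $\gamma^t(G^c)$ is the minimum size of a tropical dominating set. -}

module Defs where

open import Data.Nat using (ℕ; _+_; _∸_; _≤_; _<ᵇ_)
open import Data.Nat.ListAction using (sum)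
open import Data.Nat.Combinatorics using (_C_)
open import Data.Bool using (Bool; true; false; _∧_; if_then_else_)
open import Data.Fin using (Fin; toℕ)
open import Data.Fin.Subset using (Subset; _∈_; ∣_∣)
open import Data.List using (List; map; allFin)
open import Data.Product using (Σ; ∃; _×_)
open import Data.Sum using (_⊎_)
open import Relation.Binary.PropositionalEquality using (_≡_)

record Graph (n : ℕ) : Set where
  field
    adj    : Fin n → Fin n → Bool
    sym    : ∀ i j → adj i j ≡ adj j i
    irrefl : ∀ i → adj i i ≡ false

record VCGraph (n c : ℕ) : Set where
  field
    graph  : Graph n
    colour : Fin n → Fin c
    onto   : ∀ (a : Fin c) → ∃ λ v → colour v ≡ a
  open Graph graph public

edgeCount : ∀ {n} → Graph n → ℕ
edgeCount {n} G =
  sum (map (λ i → sum (map (λ j →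
      if (toℕ i <ᵇ toℕ j) ∧ Graph.adj G i j then 1 else 0) (allFin n))) (allFin n))

numEdges : ∀ {n c} → VCGraph n c → ℕ
numEdges G = edgeCount (VCGraph.graph G)

Dominating : ∀ {n c} → VCGraph n c → Subset n → Set
Dominating G S = ∀ v → v ∈ S ⊎ (∃ λ u → u ∈ S × VCGraph.adj G u v ≡ true)

TropicalDominating : ∀ {n c} → VCGraph n c → Subset n → Set
TropicalDominating {n} {c} G S =
  Dominating G S × (∀ (a : Fin c) → ∃ λ v → v ∈ S × VCGraph.colour G v ≡ a)

TropDomAtMost : ∀ {n c} → VCGraph n c → ℕ → Set
TropDomAtMost {n} G k = Σ (Subset n) λ S → TropicalDominating G S × ∣ S ∣ ≤ k

TropDomNumberIs : ∀ {n c} → VCGraph n c → ℕ → Set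
TropDomNumberIs {n} G k =
  (Σ (Subset n) λ S → TropicalDominating G S × ∣ S ∣ ≡ k)
  × (∀ (S : Subset n) → TropicalDominating G S → k ≤ ∣ S ∣)

-- the edge threshold  binom(n-k+c-1, 2) + (n-k)  (subtractions are exact under
-- the hypotheses c ≥ 1 and n ≥ k+c-1)
threshold : ℕ → ℕ → ℕ → ℕ
threshold n k c = ((n ∸ k + c) ∸ 1) C 2 + (n ∸ k)

module Submission where

-- Write t = n - k for the number of vertices a tropical
-- dominating set of size k must leave out, and thr t c = C(t+c-1, 2) + t
-- (so threshold n k c = thr t c).  We prove by induction on |U| a statement
-- for an arbitrary vertex set U whose colours form the set Col: if U spans at
-- least thr t |Col| edges and t < |U|, then some S ⊆ U containing a prescribed
-- vertex x dominates U, meets every colour of Col and has |S| + t ≤ |U|.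
-- The step deletes one vertex: x itself if it has no neighbour in U, otherwise
-- a neighbour v of x, which x dominates.  Deleting a vertex of degree d lowers
-- the edge count by d, while lowering t, respectively |Col|, by one lowers the
-- threshold by t + |Col| - 1, respectively t + |Col| - 2 (thr-step-t,
-- thr-step-c), so the induction applies when d is that small.  When v has large degree, S is built directly: keep one
-- representative of each colour and delete the other neighbours of v.
--
-- On vertices 0 … n-1, a clique on the first q = t + c - 1
-- vertices plus a hub q joined to t of them; the c - 1 clique vertices outside
-- the hub's neighbourhood get distinct colours 1 … c-1, everything else colour 0.
-- Its edge count is computed by adding vertices one at a time, the set of all
-- vertices but the hub's neighbours is tropical dominating of size k, and any
-- tropical dominating set contains the k - 1 uniquely coloured or isolated
-- vertices together with a dominator of the hub.

open import Defs
open import Data.Nat using (ℕ; zero; suc; _+_; _*_; _∸_; _≤_; _<_; z≤n; s≤s; _<ᵇ_; _≡ᵇ_)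
open import Data.Nat.Properties renaming (_≟_ to _≟ℕ_)
open import Data.Nat.Combinatorics using (_C_; nCk+nC[k+1]≡[n+1]C[k+1]; nC1≡n)
open import Data.Nat.ListAction using () renaming (sum to listSum)
open import Data.Nat.Tactic.RingSolver using (solve-∀)
open import Data.Bool using (Bool; true; false; _∧_; _∨_; not; if_then_else_; T)
open import Data.Bool.Properties
  using (∧-zeroʳ; ∧-identityʳ; ∨-zeroʳ; ∨-identityʳ; ∧-comm; ∨-comm; T-≡) renaming (_≟_ to _≟ᵇ_)
open import Data.Unit using (tt)
open import Data.Fin using (Fin; zero; suc; toℕ; fromℕ<; _≟_)
open import Data.Fin.Properties
  using (toℕ-injective; toℕ-fromℕ<; toℕ<n; any?) renaming (suc-injective to Fin-suc-injective; 0≢1+n to Fin-0≢1+n)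
open import Data.Fin.Subset using (Subset; _∈_; ∣_∣)
open import Data.List using (map; tabulate; allFin)
open import Data.List.Properties using (map-tabulate)
import Data.Vec as Vec
open import Data.Vec.Properties using (lookup∘tabulate; tabulate∘lookup; lookup⇒[]=; []=⇒lookup)
open import Data.Product using (Σ; ∃; _×_; _,_; proj₁; proj₂)
open import Data.Sum using (_⊎_; inj₁; inj₂)
open import Relation.Nullary using (¬_; Dec; yes; no; does; contradiction)
open import Relation.Nullary.Decidable using (dec-true; dec-false; _×-dec_; ¬?)
open import Relation.Binary.PropositionalEquality
open import Relation.Binary.Definitions using (tri<; tri≈; tri>)
open import Function using (_∘_)
open import Function.Bundles using (Equivalence)
open import Algebra.Properties.Semiring.Sum +-*-semiring
  using (sum; sum-cong-≗; sum-replicate-zero; ∑-distrib-+; *-distribˡ-sum)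

⟦_⟧ : Bool → ℕ
⟦ b ⟧ = if b then 1 else 0

Pred : ℕ → Set
Pred n = Fin n → Bool

#_ : ∀ {n} → Pred n → ℕ
# U = sum λ i → ⟦ U i ⟧

_⊆_ : ∀ {n} → Pred n → Pred n → Set
A ⊆ B = ∀ i → A i ≡ true → B i ≡ true

⁅_⁆ : ∀ {n} → Fin n → Pred n
⁅ v ⁆ i = does (i ≟ v)

_-_ : ∀ {n} → Pred n → Fin n → Pred n
(U - v) i = U i ∧ not (does (i ≟ v))

_∪⁅_⁆ : ∀ {n} → Pred n → Fin n → Pred n
(A ∪⁅ v ⁆) i = A i ∨ ⁅ v ⁆ i

sum-mono : ∀ {n} {f g : Fin n → ℕ} → (∀ i → f i ≤ g i) → sum f ≤ sum g
sum-mono {zero} f≤g = z≤n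
sum-mono {suc n} f≤g = +-mono-≤ (f≤g zero) (sum-mono (f≤g ∘ suc))

sum-zero : ∀ {n} {f : Fin n → ℕ} → (∀ i → f i ≡ 0) → sum f ≡ 0
sum-zero {n} f≡0 = trans (sum-cong-≗ f≡0) (sum-replicate-zero n)

sum-point : ∀ {n} (v : Fin n) (f : Fin n → ℕ) → sum (λ i → ⟦ ⁅ v ⁆ i ⟧ * f i) ≡ f v
sum-point {suc n} zero f = begin
  1 * f zero + sum (λ i → 0 * f (suc i)) ≡⟨ cong (1 * f zero +_) (sum-zero {n} {λ i → 0 * f (suc i)} (λ _ → refl)) ⟩
  1 * f zero + 0                          ≡⟨ +-identityʳ _ ⟩
  1 * f zero                              ≡⟨ *-identityˡ _ ⟩
  f zero                                  ∎
  where open ≡-Reasoning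
sum-point {suc n} (suc v) f = sum-point v (f ∘ suc)

record Adjoin {n} (U' : Pred n) (v : Fin n) (U : Pred n) : Set where
  constructor adjoin
  field split : ∀ i → ⟦ U i ⟧ ≡ ⟦ U' i ⟧ + ⟦ ⁅ v ⁆ i ⟧
open Adjoin public

#-adjoin : ∀ {n} {U' U : Pred n} {v} → Adjoin U' v U → # U ≡ suc (# U')
#-adjoin {n} {U'} {U} {v} U=U'+v = begin
  # U                                              ≡⟨ sum-cong-≗ (split U=U'+v) ⟩
  sum (λ i → ⟦ U' i ⟧ + ⟦ ⁅ v ⁆ i ⟧)               ≡⟨ ∑-distrib-+ (λ i → ⟦ U' i ⟧) (λ i → ⟦ ⁅ v ⁆ i ⟧) ⟩
  # U' + sum (λ i → ⟦ ⁅ v ⁆ i ⟧)                  ≡⟨ cong (# U' +_) (sum-cong-≗ (λ i → sym (*-identityʳ ⟦ ⁅ v ⁆ i ⟧))) ⟩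
  # U' + sum (λ i → ⟦ ⁅ v ⁆ i ⟧ * 1)              ≡⟨ cong (# U' +_) (sum-point v (λ _ → 1)) ⟩
  # U' + 1                                       ≡⟨ +-comm (# U') 1 ⟩
  suc (# U')                                     ∎
  where open ≡-Reasoning

-self : ∀ {n} (U : Pred n) v → (U - v) v ≡ false
-self U v rewrite dec-true (v ≟ v) refl = ∧-zeroʳ (U v)

-other : ∀ {n} (U : Pred n) {v i} → ¬ i ≡ v → (U - v) i ≡ U i
-other U {v} {i} i≢v rewrite dec-false (i ≟ v) i≢v = ∧-identityʳ (U i)

-⊆ : ∀ {n} (U : Pred n) v → (U - v) ⊆ U
-⊆ U v i p with U i
... | true  = refl
... | false = p

-member : ∀ {n} (U : Pred n) {v i} → (U - v) i ≡ true → ¬ i ≡ v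
-member U {v} i∈U-v refl with () ← trans (sym i∈U-v) (-self U v)

-recover : ∀ {n} (A : Pred n) v {i} → A i ≡ true → (A - v) i ≡ true ⊎ i ≡ v
-recover A v {i} Ai with i ≟ v
... | yes i≡v = inj₂ i≡v
... | no i≢v  = inj₁ (trans (∧-identityʳ (A i)) Ai)

∪⁅⁆-self : ∀ {n} (A : Pred n) v → (A ∪⁅ v ⁆) v ≡ true
∪⁅⁆-self A v rewrite dec-true (v ≟ v) refl = ∨-zeroʳ (A v)

∪⁅⁆-⊇ : ∀ {n} (A : Pred n) v → A ⊆ (A ∪⁅ v ⁆)
∪⁅⁆-⊇ A v i Ai rewrite Ai = refl

adjoin-remove : ∀ {n} (U : Pred n) v → U v ≡ true → Adjoin (U - v) v U
adjoin-remove U v Uv = adjoin split-at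
  where
  split-at : ∀ i → ⟦ U i ⟧ ≡ ⟦ (U - v) i ⟧ + ⟦ ⁅ v ⁆ i ⟧
  split-at i with i ≟ v
  ... | yes refl rewrite Uv = refl
  ... | no i≢v   rewrite ∧-identityʳ (U i) = sym (+-identityʳ ⟦ U i ⟧)

adjoin-insert : ∀ {n} (A : Pred n) v → A v ≡ false → Adjoin A v (A ∪⁅ v ⁆)
adjoin-insert A v Av = adjoin split-at
  where
  split-at : ∀ i → ⟦ (A ∪⁅ v ⁆) i ⟧ ≡ ⟦ A i ⟧ + ⟦ ⁅ v ⁆ i ⟧
  split-at i with i ≟ v
  ... | yes refl rewrite Av = refl
  ... | no _     rewrite ∨-identityʳ (A i) = sym (+-identityʳ ⟦ A i ⟧)

#-remove : ∀ {n} (U : Pred n) v → U v ≡ true → # U ≡ suc (# (U - v))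
#-remove U v Uv = #-adjoin (adjoin-remove U v Uv)

#-remove-suc : ∀ {n s} (U : Pred n) v → U v ≡ true → # U ≡ suc s → # (U - v) ≡ s
#-remove-suc U v Uv #U≡1+s = suc-injective (trans (sym (#-remove U v Uv)) #U≡1+s)

#-mono : ∀ {n} {A B : Pred n} → A ⊆ B → # A ≤ # B
#-mono {A = A} {B} A⊆B = sum-mono pointwise
  where
  pointwise : ∀ i → ⟦ A i ⟧ ≤ ⟦ B i ⟧
  pointwise i with A i | A⊆B i
  ... | true  | Bi = ≤-reflexive (cong ⟦_⟧ (sym (Bi refl)))
  ... | false | _  = z≤n

#-nonempty : ∀ {n} (U : Pred n) → 0 < # U → ∃ λ i → U i ≡ true
#-nonempty {suc n} U #U>0 with U zero in U0
... | true  = zero , U0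
... | false with #-nonempty (U ∘ suc) #U>0
...   | i , Ui = suc i , Ui

#-member : ∀ {n} {U : Pred n} {v} → U v ≡ true → 1 ≤ # U
#-member {U = U} {v} Uv rewrite #-remove U v Uv = s≤s z≤n

#-empty : ∀ {n} (U : Pred n) → # U ≡ 0 → ∀ i → U i ≡ false
#-empty U #U≡0 i with U i in Ui
... | false = refl
... | true  = contradiction (subst (1 ≤_) #U≡0 (#-member {U = U} Ui)) λ ()

#-full : ∀ n → # (λ (_ : Fin n) → true) ≡ n
#-full zero    = refl
#-full (suc n) = cong suc (#-full n)

#-complement : ∀ {n} (A : Pred n) → # (not ∘ A) + # A ≡ n
#-complement {n} A = begin
  # (not ∘ A) + # A                        ≡⟨ sym (∑-distrib-+ (λ i → ⟦ not (A i) ⟧) (λ i → ⟦ A i ⟧)) ⟩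
  sum (λ i → ⟦ not (A i) ⟧ + ⟦ A i ⟧)        ≡⟨ sum-cong-≗ pointwise ⟩
  # (λ (_ : Fin n) → true)                 ≡⟨ #-full n ⟩
  n                                        ∎
  where
  open ≡-Reasoning
  pointwise : ∀ i → ⟦ not (A i) ⟧ + ⟦ A i ⟧ ≡ 1
  pointwise i with A i
  ... | true  = refl
  ... | false = refl

InjectiveOn : ∀ {n m} → Pred n → (Fin n → Fin m) → Set
InjectiveOn A f = ∀ u w → A u ≡ true → A w ≡ true → f u ≡ f w → u ≡ w

injectiveOn-suc : ∀ {n m} {A : Pred (suc n)} {f : Fin (suc n) → Fin m}
  → InjectiveOn A f → InjectiveOn (A ∘ suc) (f ∘ suc)
injectiveOn-suc inj u w Au Aw fu≡fw = Fin-suc-injective (inj (suc u) (suc w) Au Aw fu≡fw)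

#-injection : ∀ {n m} (A : Pred n) (B : Pred m) (f : Fin n → Fin m)
  → (∀ u → A u ≡ true → B (f u) ≡ true) → InjectiveOn A f → # A ≤ # B
#-injection {zero} A B f maps inj = z≤n
#-injection {suc n} A B f maps inj with A zero in A0
... | false = #-injection (A ∘ suc) B (f ∘ suc) (maps ∘ suc) (injectiveOn-suc inj)
... | true rewrite #-remove B (f zero) (maps zero A0) =
  s≤s (#-injection (A ∘ suc) (B - f zero) (f ∘ suc) maps-rest (injectiveOn-suc inj))
  where
  maps-rest : ∀ u → A (suc u) ≡ true → (B - f zero) (f (suc u)) ≡ true
  maps-rest u Au = trans (-other B (λ f≡ → Fin-0≢1+n (sym (inj (suc u) zero Au A0 f≡)))) (maps (suc u) Au)

<ᵇ-true : ∀ {m n} → m < n → (m <ᵇ n) ≡ true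
<ᵇ-true m<n = Equivalence.to T-≡ (<⇒<ᵇ m<n)

<ᵇ-false : ∀ {m n} → ¬ m < n → (m <ᵇ n) ≡ false
<ᵇ-false {m} {n} m≮n with m <ᵇ n in m<ᵇn
... | false = refl
... | true  = contradiction (<ᵇ⇒< m n (subst T (sym m<ᵇn) tt)) m≮n

≡ᵇ-true : ∀ {m n} → m ≡ n → (m ≡ᵇ n) ≡ true
≡ᵇ-true {m} {n} m≡n = Equivalence.to T-≡ (≡⇒≡ᵇ m n m≡n)

≡ᵇ-false : ∀ {m n} → ¬ m ≡ n → (m ≡ᵇ n) ≡ false
≡ᵇ-false {m} {n} m≢n with m ≡ᵇ n in m≡ᵇn
... | false = refl
... | true  = contradiction (≡ᵇ⇒≡ m n (subst T (sym m≡ᵇn) tt)) m≢n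

≡ᵇ-sym : ∀ m n → (m ≡ᵇ n) ≡ (n ≡ᵇ m)
≡ᵇ-sym m n with m ≟ℕ n
... | yes refl = refl
... | no m≢n   = trans (≡ᵇ-false m≢n) (sym (≡ᵇ-false (m≢n ∘ sym)))

C2-suc : ∀ s → suc s C 2 ≡ s C 2 + s
C2-suc s = trans (sym (nCk+nC[k+1]≡[n+1]C[k+1] s 1)) (trans (cong (_+ s C 2) (nC1≡n s)) (+-comm s (s C 2)))

C2-mono : ∀ {a b} → a ≤ b → a C 2 ≤ b C 2
C2-mono {b = zero} z≤n = ≤-refl
C2-mono {a} {suc b} a≤1+b with m≤n⇒m<n∨m≡n a≤1+b
... | inj₂ refl  = ≤-refl
... | inj₁ a<1+b = ≤-trans (C2-mono (≤-pred a<1+b)) (≤-trans (m≤m+n (b C 2) b) (≤-reflexive (sym (C2-suc b))))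

listSum-allFin : ∀ {n} (f : Fin n → ℕ) → listSum (map f (allFin n)) ≡ sum f
listSum-allFin {zero} f = refl
listSum-allFin {suc n} f = cong (f zero +_) (begin
  listSum (map f (tabulate suc))         ≡⟨ cong listSum (map-tabulate suc f) ⟩
  listSum (tabulate (f ∘ suc))                ≡⟨ cong listSum (sym (map-tabulate (λ i → i) (f ∘ suc))) ⟩
  listSum (map (f ∘ suc) (allFin n))          ≡⟨ listSum-allFin (f ∘ suc) ⟩
  sum (f ∘ suc)                                     ∎)
  where open ≡-Reasoning

module EdgeCount {n : ℕ} (G : Graph n) where
  open Graph G renaming (sym to adj-sym; irrefl to adj-irrefl)

  edge : Fin n → Fin n → Bool
  edge i j = (toℕ i <ᵇ toℕ j) ∧ adj i j

  χ : Pred n → Fin n → ℕ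
  χ U i = ⟦ U i ⟧

  between : (Fin n → ℕ) → (Fin n → ℕ) → ℕ
  between a b = sum λ i → sum λ j → a i * b j * ⟦ edge i j ⟧

  E : Pred n → ℕ
  E U = between (χ U) (χ U)

  deg : Pred n → Fin n → ℕ
  deg U v = sum λ j → ⟦ U j ⟧ * ⟦ adj v j ⟧

  edgeCount≡E : edgeCount G ≡ E (λ _ → true)
  edgeCount≡E = trans (listSum-allFin (λ i → listSum (map (λ j → ⟦ edge i j ⟧) (allFin n))))
    (sum-cong-≗ λ i → trans (listSum-allFin (λ j → ⟦ edge i j ⟧)) (sum-cong-≗ λ j → sym (*-identityˡ ⟦ edge i j ⟧)))

  between-cong : ∀ {a a' b b'} → (∀ i → a i ≡ a' i) → (∀ j → b j ≡ b' j) → between a b ≡ between a' b'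
  between-cong a≗a' b≗b' =
    sum-cong-≗ λ i → sum-cong-≗ λ j → cong₂ (λ x y → x * y * ⟦ edge i j ⟧) (a≗a' i) (b≗b' j)

  between-+ˡ : ∀ a a' b → between (λ i → a i + a' i) b ≡ between a b + between a' b
  between-+ˡ a a' b =
    trans (sum-cong-≗ λ i → trans (sum-cong-≗ (distrib i)) (∑-distrib-+ (term a i) (term a' i)))
          (∑-distrib-+ (λ i → sum (term a i)) (λ i → sum (term a' i)))
    where
    term : (Fin n → ℕ) → Fin n → Fin n → ℕ
    term w i j = w i * b j * ⟦ edge i j ⟧
    distrib : ∀ i j → (a i + a' i) * b j * ⟦ edge i j ⟧ ≡ a i * b j * ⟦ edge i j ⟧ + a' i * b j * ⟦ edge i j ⟧
    distrib i j = trans (cong (_* ⟦ edge i j ⟧) (*-distribʳ-+ (b j) (a i) (a' i)))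
                        (*-distribʳ-+ ⟦ edge i j ⟧ (a i * b j) (a' i * b j))

  between-+ʳ : ∀ a b b' → between a (λ j → b j + b' j) ≡ between a b + between a b'
  between-+ʳ a b b' =
    trans (sum-cong-≗ λ i → trans (sum-cong-≗ (distrib i)) (∑-distrib-+ (term b i) (term b' i)))
          (∑-distrib-+ (λ i → sum (term b i)) (λ i → sum (term b' i)))
    where
    term : (Fin n → ℕ) → Fin n → Fin n → ℕ
    term w i j = a i * w j * ⟦ edge i j ⟧
    distrib : ∀ i j → a i * (b j + b' j) * ⟦ edge i j ⟧ ≡ a i * b j * ⟦ edge i j ⟧ + a i * b' j * ⟦ edge i j ⟧
    distrib i j = trans (cong (_* ⟦ edge i j ⟧) (*-distribˡ-+ (a i) (b j) (b' j)))
                        (*-distribʳ-+ ⟦ edge i j ⟧ (a i * b j) (a i * b' j))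

  between-pointˡ : ∀ v b → between (χ ⁅ v ⁆) b ≡ sum λ j → b j * ⟦ edge v j ⟧
  between-pointˡ v b = begin
    sum (λ i → sum λ j → ⟦ ⁅ v ⁆ i ⟧ * b j * ⟦ edge i j ⟧)
      ≡⟨ sum-cong-≗ (λ i → trans (sum-cong-≗ λ j → *-assoc ⟦ ⁅ v ⁆ i ⟧ (b j) ⟦ edge i j ⟧)
                                 (sym (*-distribˡ-sum ⟦ ⁅ v ⁆ i ⟧ λ j → b j * ⟦ edge i j ⟧))) ⟩
    sum (λ i → ⟦ ⁅ v ⁆ i ⟧ * sum λ j → b j * ⟦ edge i j ⟧)
      ≡⟨ sum-point v (λ i → sum λ j → b j * ⟦ edge i j ⟧) ⟩
    sum (λ j → b j * ⟦ edge v j ⟧) ∎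
    where open ≡-Reasoning

  between-pointʳ : ∀ a v → between a (χ ⁅ v ⁆) ≡ sum λ i → a i * ⟦ edge i v ⟧
  between-pointʳ a v = sum-cong-≗ λ i → begin
    sum (λ j → a i * ⟦ ⁅ v ⁆ j ⟧ * ⟦ edge i j ⟧)   ≡⟨ sum-cong-≗ (λ j → swap (a i) ⟦ ⁅ v ⁆ j ⟧ ⟦ edge i j ⟧) ⟩
    sum (λ j → ⟦ ⁅ v ⁆ j ⟧ * (a i * ⟦ edge i j ⟧)) ≡⟨ sum-point v (λ j → a i * ⟦ edge i j ⟧) ⟩
    a i * ⟦ edge i v ⟧                            ∎
    where
    open ≡-Reasoning
    swap : ∀ x y z → x * y * z ≡ y * (x * z)
    swap x y z = trans (cong (_* z) (*-comm x y)) (*-assoc y x z)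

  edge-loop : ∀ v → ⟦ edge v v ⟧ ≡ 0
  edge-loop v rewrite adj-irrefl v = cong ⟦_⟧ (∧-zeroʳ (toℕ v <ᵇ toℕ v))

  edge-pair : ∀ v j → ⟦ edge v j ⟧ + ⟦ edge j v ⟧ ≡ ⟦ adj v j ⟧
  edge-pair v j rewrite adj-sym j v with <-cmp (toℕ v) (toℕ j)
  ... | tri< v<j _ v≯j rewrite <ᵇ-true v<j | <ᵇ-false v≯j = +-identityʳ ⟦ adj v j ⟧
  ... | tri> v≮j _ v>j rewrite <ᵇ-true v>j | <ᵇ-false v≮j = refl
  ... | tri≈ _ v≡j _ rewrite toℕ-injective v≡j | adj-irrefl j = cong (λ b → ⟦ b ⟧ + ⟦ b ⟧) (∧-zeroʳ (toℕ j <ᵇ toℕ j))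

  E-adjoin : ∀ {U' U : Pred n} {v} → Adjoin U' v U → E U ≡ E U' + deg U' v
  E-adjoin {U'} {U} {v} U=U'+v = begin
    E U
      ≡⟨ between-cong (split U=U'+v) (split U=U'+v) ⟩
    between (λ i → a i + δ i) (λ j → a j + δ j)
      ≡⟨ between-+ˡ a δ (λ j → a j + δ j) ⟩
    between a (λ j → a j + δ j) + between δ (λ j → a j + δ j)
      ≡⟨ cong₂ _+_ (between-+ʳ a a δ) (between-+ʳ δ a δ) ⟩
    (E U' + between a δ) + (between δ a + between δ δ)
      ≡⟨ cong (λ x → E U' + between a δ + (between δ a + x)) δδ≡0 ⟩
    (E U' + between a δ) + (between δ a + 0)
      ≡⟨ cong (E U' + between a δ +_) (+-identityʳ (between δ a)) ⟩
    (E U' + between a δ) + between δ a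
      ≡⟨ +-assoc (E U') (between a δ) (between δ a) ⟩
    E U' + (between a δ + between δ a)
      ≡⟨ cong (E U' +_) cross ⟩
    E U' + deg U' v ∎
    where
    open ≡-Reasoning
    a δ : Fin n → ℕ
    a = χ U'
    δ = χ ⁅ v ⁆
    δδ≡0 : between δ δ ≡ 0
    δδ≡0 = trans (between-pointˡ v δ) (trans (sum-point v (λ j → ⟦ edge v j ⟧)) (edge-loop v))
    cross : between a δ + between δ a ≡ deg U' v
    cross = begin
      between a δ + between δ a
        ≡⟨ cong₂ _+_ (between-pointʳ a v) (between-pointˡ v a) ⟩
      sum (λ j → a j * ⟦ edge j v ⟧) + sum (λ j → a j * ⟦ edge v j ⟧)
        ≡⟨ sym (∑-distrib-+ (λ j → a j * ⟦ edge j v ⟧) (λ j → a j * ⟦ edge v j ⟧)) ⟩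
      sum (λ j → a j * ⟦ edge j v ⟧ + a j * ⟦ edge v j ⟧)
        ≡⟨ sum-cong-≗ (λ j → trans (sym (*-distribˡ-+ (a j) ⟦ edge j v ⟧ ⟦ edge v j ⟧))
                                   (cong (a j *_) (trans (+-comm ⟦ edge j v ⟧ ⟦ edge v j ⟧) (edge-pair v j)))) ⟩
      deg U' v ∎

  E-remove : ∀ U v → U v ≡ true → E U ≡ E (U - v) + deg (U - v) v
  E-remove U v Uv = E-adjoin (adjoin-remove U v Uv)

  deg-≤ : ∀ U v → deg U v ≤ # U
  deg-≤ U v = sum-mono pointwise
    where
    pointwise : ∀ j → ⟦ U j ⟧ * ⟦ adj v j ⟧ ≤ ⟦ U j ⟧
    pointwise j with adj v j
    ... | true  = ≤-reflexive (*-identityʳ ⟦ U j ⟧)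
    ... | false = subst (_≤ ⟦ U j ⟧) (sym (*-zeroʳ ⟦ U j ⟧)) z≤n

  E-≤ : ∀ U → E U ≤ # U C 2
  E-≤ U = bound (# U) U refl
    where
    bound : ∀ s U → # U ≡ s → E U ≤ s C 2
    bound zero U #U≡0 = ≤-reflexive (sum-zero λ i → sum-zero λ j → cong (λ x → x * ⟦ U j ⟧ * ⟦ edge i j ⟧) (χU≡0 i))
      where
      χU≡0 : ∀ i → ⟦ U i ⟧ ≡ 0
      χU≡0 i = cong ⟦_⟧ (#-empty U #U≡0 i)
    bound (suc s) U #U≡1+s with #-nonempty U (subst (0 <_) (sym #U≡1+s) (s≤s z≤n))
    ... | v , Uv = begin
      E U                           ≡⟨ E-remove U v Uv ⟩
      E (U - v) + deg (U - v) v     ≤⟨ +-mono-≤ (bound s (U - v) #U-v≡s) (≤-trans (deg-≤ (U - v) v) (≤-reflexive #U-v≡s)) ⟩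
      s C 2 + s                     ≡⟨ sym (C2-suc s) ⟩
      suc s C 2                     ∎
      where
      open ≤-Reasoning
      #U-v≡s : # (U - v) ≡ s
      #U-v≡s = #-remove-suc U v Uv #U≡1+s

thr : ℕ → ℕ → ℕ
thr t c = (t + c ∸ 1) C 2 + t

thr-suc : ∀ t c → thr t (suc c) ≡ (t + c) C 2 + t
thr-suc t c = cong (λ m → (m ∸ 1) C 2 + t) (+-suc t c)

thr-step-t : ∀ t {c} → 1 ≤ c → thr (suc t) c ≡ thr t c + (t + c)
thr-step-t t {suc c} _ = begin
  thr (suc t) (suc c)               ≡⟨ thr-suc (suc t) c ⟩
  suc (t + c) C 2 + suc t           ≡⟨ cong (_+ suc t) (C2-suc (t + c)) ⟩
  (t + c) C 2 + (t + c) + suc t     ≡⟨ rearrange ((t + c) C 2) (t + c) t ⟩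
  (t + c) C 2 + t + suc (t + c)     ≡⟨ cong₂ (λ x y → x + y) (sym (thr-suc t c)) (sym (+-suc t c)) ⟩
  thr t (suc c) + (t + suc c)       ∎
  where
  open ≡-Reasoning
  rearrange : ∀ x y z → x + y + suc z ≡ x + z + suc y
  rearrange = solve-∀

thr-step-c : ∀ t c → thr (suc t) (suc c) ≡ thr (suc t) c + (t + c)
thr-step-c t c = begin
  thr (suc t) (suc c)               ≡⟨ thr-suc (suc t) c ⟩
  suc (t + c) C 2 + suc t           ≡⟨ cong (_+ suc t) (C2-suc (t + c)) ⟩
  (t + c) C 2 + (t + c) + suc t     ≡⟨ rearrange ((t + c) C 2) (t + c) (suc t) ⟩
  (t + c) C 2 + suc t + (t + c)     ≡⟨⟩
  thr (suc t) c + (t + c)           ∎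
  where
  open ≡-Reasoning
  rearrange : ∀ x y z → x + y + z ≡ x + z + y
  rearrange = solve-∀

thr-mono-c : ∀ t {c c'} → c ≤ c' → thr t c ≤ thr t c'
thr-mono-c t c≤c' = +-monoˡ-≤ t (C2-mono (∸-monoˡ-≤ 1 (+-monoʳ-≤ t c≤c')))

C2<thr : ∀ {s t c} → 0 < t → s ≤ t + c ∸ 1 → s C 2 < thr t c
C2<thr {s} {t} {c} t>0 s≤ = begin-strict
  s C 2               ≤⟨ C2-mono s≤ ⟩
  (t + c ∸ 1) C 2     <⟨ m<m+n _ t>0 ⟩
  thr t c             ∎
  where open ≤-Reasoning

-- If deleting a vertex of degree d ≤ b from a set with E edges must respect a
-- threshold that is b smaller, the remaining E - d edges still meet it.
cancel-degree : ∀ {big small b E d} → big ≡ small + b → big ≤ E + d → d ≤ b → small ≤ E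
cancel-degree {big} {small} {b} {E} {d} big≡ big≤ d≤b = +-cancelʳ-≤ b small E (begin
  small + b  ≡⟨ sym big≡ ⟩
  big        ≤⟨ big≤ ⟩
  E + d      ≤⟨ +-monoʳ-≤ E d≤b ⟩
  E + b      ∎)
  where open ≤-Reasoning

module Saving {n c : ℕ} (G : VCGraph n c) where
  open VCGraph G using (adj; colour) renaming (irrefl to adj-irrefl)
  open EdgeCount (VCGraph.graph G)

  record Palette (U : Pred n) (Col : Pred c) : Set where
    field
      occurring : ∀ u → U u ≡ true → Col (colour u) ≡ true
      realised  : ∀ a → Col a ≡ true → ∃ λ u → U u ≡ true × colour u ≡ a
  open Palette

  Dominates : Pred n → Pred n → Set
  Dominates U S = ∀ u → U u ≡ true → S u ≡ true ⊎ ∃ λ s → S s ≡ true × adj s u ≡ true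

  Covers : Pred c → Pred n → Set
  Covers Col S = ∀ a → Col a ≡ true → ∃ λ s → S s ≡ true × colour s ≡ a

  record Solution (U : Pred n) (Col : Pred c) (t : ℕ) (x : Fin n) : Set where
    field
      S         : Pred n
      S⊆U       : S ⊆ U
      x∈S       : S x ≡ true
      dominates : Dominates U S
      covers    : Covers Col S
      saves     : # S + t ≤ # U
  open Solution

  everything : ∀ {U Col x} → Palette U Col → U x ≡ true → Solution U Col 0 x
  everything {U} pal Ux = record
    { S = U ; S⊆U = λ _ Ui → Ui ; x∈S = Ux ; dominates = λ _ Ui → inj₁ Ui
    ; covers = realised pal ; saves = ≤-reflexive (+-identityʳ (# U)) }

  Repeated : Pred n → Fin n → Set
  Repeated U w = ∃ λ w' → U w' ≡ true × ¬ w' ≡ w × colour w' ≡ colour w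

  Unique : Pred n → Fin n → Set
  Unique U w = ∀ u → U u ≡ true → colour u ≡ colour w → u ≡ w

  repeated-or-unique : ∀ U w → Repeated U w ⊎ Unique U w
  repeated-or-unique U w with any? (λ w' → (U w' ≟ᵇ true) ×-dec (¬? (w' ≟ w) ×-dec (colour w' ≟ colour w)))
  ... | yes repeated = inj₁ repeated
  ... | no ¬repeated = inj₂ unique
    where
    unique : Unique U w
    unique u Uu cu≡cw with u ≟ w
    ... | yes u≡w = u≡w
    ... | no u≢w  = contradiction (u , Uu , u≢w , cu≡cw) ¬repeated

  palette-keep : ∀ {U Col w} → Palette U Col → Repeated U w → Palette (U - w) Col
  palette-keep {U} {Col} {w} pal (w' , Uw' , w'≢w , cw'≡cw) = record
    { occurring = λ u U-w∋u → occurring pal u (-⊆ U w u U-w∋u) ; realised = realised' }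
    where
    realised' : ∀ a → Col a ≡ true → ∃ λ u → (U - w) u ≡ true × colour u ≡ a
    realised' a Col∋a with realised pal a Col∋a
    ... | u , Uu , cu≡a with -recover U w Uu
    ...   | inj₁ U-w∋u = u , U-w∋u , cu≡a
    ...   | inj₂ refl  = w' , trans (-other U w'≢w) Uw' , trans cw'≡cw cu≡a

  palette-drop : ∀ {U Col w} → Palette U Col → Unique U w → Palette (U - w) (Col - colour w)
  palette-drop {U} {Col} {w} pal unique = record { occurring = occurring' ; realised = realised' }
    where
    occurring' : ∀ u → (U - w) u ≡ true → (Col - colour w) (colour u) ≡ true
    occurring' u U-w∋u = trans (-other Col (-member U U-w∋u ∘ unique u (-⊆ U w u U-w∋u)))
                               (occurring pal u (-⊆ U w u U-w∋u))
    realised' : ∀ a → (Col - colour w) a ≡ true → ∃ λ u → (U - w) u ≡ true × colour u ≡ a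
    realised' a Col-cw∋a with realised pal a (-⊆ Col (colour w) a Col-cw∋a)
    ... | u , Uu , cu≡a = u , trans (-other U u≢w) Uu , cu≡a
      where
      u≢w : ¬ u ≡ w
      u≢w refl = -member Col Col-cw∋a (sym cu≡a)

  add-vertex : ∀ {U Col Col' t x' x w} → Solution (U - w) Col' t x' → U w ≡ true
    → (∀ a → Col a ≡ true → Col' a ≡ true ⊎ a ≡ colour w) → x ≡ w ⊎ x ≡ x'
    → Solution U Col t x
  add-vertex {U} {Col} {Col'} {t} {x'} {x} {w} sol Uw Col⊆Col'+cw x-choice = record
    { S = S' ∪⁅ w ⁆ ; S⊆U = S⊆U' ; x∈S = x∈S' x-choice ; dominates = dominates'
    ; covers = covers' ; saves = saves' }
    where
    S' : Pred n
    S' = S sol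
    S⊆U' : (S' ∪⁅ w ⁆) ⊆ U
    S⊆U' i S'+w∋i with S' i in S'i | i ≟ w
    ... | true  | _        = -⊆ U w i (S⊆U sol i S'i)
    ... | false | yes refl = Uw
    x∈S' : x ≡ w ⊎ x ≡ x' → (S' ∪⁅ w ⁆) x ≡ true
    x∈S' (inj₁ refl) = ∪⁅⁆-self S' w
    x∈S' (inj₂ refl) = ∪⁅⁆-⊇ S' w x (x∈S sol)
    dominates' : Dominates U (S' ∪⁅ w ⁆)
    dominates' u Uu with -recover U w Uu
    ... | inj₂ refl = inj₁ (∪⁅⁆-self S' w)
    ... | inj₁ U-w∋u with dominates sol u U-w∋u
    ...   | inj₁ S'u             = inj₁ (∪⁅⁆-⊇ S' w u S'u)
    ...   | inj₂ (s , S's , s~u) = inj₂ (s , ∪⁅⁆-⊇ S' w s S's , s~u)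
    covers' : Covers Col (S' ∪⁅ w ⁆)
    covers' a Col∋a with Col⊆Col'+cw a Col∋a
    ... | inj₂ refl = w , ∪⁅⁆-self S' w , refl
    ... | inj₁ Col'∋a with covers sol a Col'∋a
    ...   | s , S's , cs≡a = s , ∪⁅⁆-⊇ S' w s S's , cs≡a
    w∉S' : S' w ≡ false
    w∉S' with S' w in S'w
    ... | false = refl
    ... | true  = contradiction (S⊆U sol w S'w) (λ U-w∋w → -member U U-w∋w refl)
    saves' : # (S' ∪⁅ w ⁆) + t ≤ # U
    saves' = begin
      # (S' ∪⁅ w ⁆) + t   ≡⟨ cong (_+ t) (#-adjoin (adjoin-insert S' w w∉S')) ⟩
      suc (# S' + t)      ≤⟨ s≤s (saves sol) ⟩
      suc (# (U - w))     ≡⟨ sym (#-remove U w Uw) ⟩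
      # U                 ∎
      where open ≤-Reasoning

  save-neighbour : ∀ {U Col t x v} → Solution (U - v) Col t x → U v ≡ true → adj x v ≡ true
    → Solution U Col (suc t) x
  save-neighbour {U} {Col} {t} {x} {v} sol Uv x~v = record
    { S = S sol ; S⊆U = λ i Si → -⊆ U v i (S⊆U sol i Si) ; x∈S = x∈S sol
    ; dominates = dominates' ; covers = covers sol ; saves = saves' }
    where
    dominates' : Dominates U (S sol)
    dominates' u Uu with -recover U v Uu
    ... | inj₁ U-v∋u = dominates sol u U-v∋u
    ... | inj₂ refl  = inj₂ (x , x∈S sol , x~v)
    saves' : # (S sol) + suc t ≤ # U
    saves' = begin
      # (S sol) + suc t   ≡⟨ +-suc (# (S sol)) t ⟩
      suc (# (S sol) + t) ≤⟨ s≤s (saves sol) ⟩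
      suc (# (U - v))     ≡⟨ sym (#-remove U v Uv) ⟩
      # U                 ∎
      where open ≤-Reasoning

  -- The star construction: if v ∈ U has many neighbours in U, keep one
  -- representative of every colour (x for its own colour) and drop all other
  -- neighbours of v; they are dominated by v.
  module Star {U : Pred n} {Col : Pred c} {x v : Fin n}
              (pal : Palette U Col) (Ux : U x ≡ true) (Uv : U v ≡ true) where

    rep : Fin c → Fin n
    rep a with colour x ≟ a
    ... | yes _ = x
    ... | no _ with any? (λ u → (U u ≟ᵇ true) ×-dec (colour u ≟ a))
    ...   | yes (u , _) = u
    ...   | no _        = x

    rep-x : rep (colour x) ≡ x
    rep-x with colour x ≟ colour x
    ... | yes _    = refl
    ... | no cx≢cx = contradiction refl cx≢cx

    rep-ok : ∀ a → Col a ≡ true → U (rep a) ≡ true × colour (rep a) ≡ a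
    rep-ok a Col∋a with colour x ≟ a
    ... | yes cx≡a = Ux , cx≡a
    ... | no _ with any? (λ u → (U u ≟ᵇ true) ×-dec (colour u ≟ a))
    ...   | yes (u , Uu , cu≡a) = Uu , cu≡a
    ...   | no none             = contradiction (realised pal a Col∋a) none

    Rep : Pred n
    Rep u = does (rep (colour u) ≟ u)

    Dropped Kept : Pred n
    Dropped u = (U - v) u ∧ (adj v u ∧ not (Rep u))
    Kept    u = (U - v) u ∧ (adj v u ∧ Rep u)

    S★ : Pred n
    S★ u = U u ∧ not (Dropped u)

    rep-not-dropped : ∀ u → Rep u ≡ true → Dropped u ≡ false
    rep-not-dropped u Rep∋u rewrite Rep∋u | ∧-zeroʳ (adj v u) = ∧-zeroʳ ((U - v) u)

    S★-member : ∀ u → U u ≡ true → Dropped u ≡ false → S★ u ≡ true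
    S★-member u Uu u-kept rewrite Uu | u-kept = refl

    v∈S★ : S★ v ≡ true
    v∈S★ = S★-member v Uv (cong (_∧ (adj v v ∧ not (Rep v))) (-self U v))

    x∈S★ : S★ x ≡ true
    x∈S★ = S★-member x Ux (rep-not-dropped x (dec-true (rep (colour x) ≟ x) rep-x))

    dropped-⊆ : Dropped ⊆ (U - v)
    dropped-⊆ u Dropped∋u with (U - v) u
    ... | true = refl

    kept-⊆ : Kept ⊆ (U - v)
    kept-⊆ u Kept∋u with (U - v) u
    ... | true = refl

    dominated : ∀ u → Dropped u ≡ true → adj v u ≡ true
    dominated u Dropped∋u with (U - v) u | adj v u
    ... | true | true = refl

    kept-injective : InjectiveOn Kept colour
    kept-injective u w Kept∋u Kept∋w cu≡cw =
      trans (sym (rep-of u Kept∋u)) (trans (cong rep cu≡cw) (rep-of w Kept∋w))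
      where
      rep-of : ∀ z → Kept z ≡ true → rep (colour z) ≡ z
      rep-of z Kept∋z with (U - v) z | adj v z | rep (colour z) ≟ z
      ... | true | true | yes rep≡z = rep≡z

    #U≡ : # U ≡ # S★ + # Dropped
    #U≡ = trans (sum-cong-≗ pointwise) (∑-distrib-+ (λ u → ⟦ S★ u ⟧) (λ u → ⟦ Dropped u ⟧))
      where
      pointwise : ∀ u → ⟦ U u ⟧ ≡ ⟦ S★ u ⟧ + ⟦ Dropped u ⟧
      pointwise u with Dropped u in Dropped-u
      ... | false = sym (trans (+-identityʳ _) (cong ⟦_⟧ (∧-identityʳ (U u))))
      ... | true rewrite -⊆ U v u (dropped-⊆ u Dropped-u) = refl

    deg≡ : deg (U - v) v ≡ # Dropped + # Kept
    deg≡ = trans (sum-cong-≗ pointwise) (∑-distrib-+ (λ u → ⟦ Dropped u ⟧) (λ u → ⟦ Kept u ⟧))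
      where
      pointwise : ∀ u → ⟦ (U - v) u ⟧ * ⟦ adj v u ⟧ ≡ ⟦ Dropped u ⟧ + ⟦ Kept u ⟧
      pointwise u with (U - v) u | adj v u | Rep u
      ... | false | _     | _     = refl
      ... | true  | false | _     = refl
      ... | true  | true  | true  = refl
      ... | true  | true  | false = refl

    star : ∀ t b → # Kept ≤ b → t + b ≤ deg (U - v) v → Solution U Col t x
    star t b #Kept≤b t+b≤deg = record
      { S = S★ ; S⊆U = λ u S★∋u → ∧-l (U u) S★∋u ; x∈S = x∈S★ ; dominates = dominates'
      ; covers = covers' ; saves = saves' }
      where
      ∧-l : ∀ a {b} → a ∧ b ≡ true → a ≡ true
      ∧-l true _ = refl
      dominates' : Dominates U S★
      dominates' u Uu with Dropped u in Dropped-u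
      ... | false = inj₁ (trans (∧-identityʳ (U u)) Uu)
      ... | true  = inj₂ (v , v∈S★ , dominated u Dropped-u)
      covers' : Covers Col S★
      covers' a Col∋a = rep a , S★-member (rep a) (proj₁ (rep-ok a Col∋a)) (rep-not-dropped (rep a) rep-rep)
                              , proj₂ (rep-ok a Col∋a)
        where
        rep-rep : Rep (rep a) ≡ true
        rep-rep = dec-true (rep (colour (rep a)) ≟ rep a) (cong rep (proj₂ (rep-ok a Col∋a)))
      t≤#Dropped : t ≤ # Dropped
      t≤#Dropped = +-cancelʳ-≤ b t (# Dropped) (begin
        t + b              ≤⟨ t+b≤deg ⟩
        deg (U - v) v      ≡⟨ deg≡ ⟩
        # Dropped + # Kept ≤⟨ +-monoʳ-≤ (# Dropped) #Kept≤b ⟩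
        # Dropped + b      ∎)
        where open ≤-Reasoning
      saves' : # S★ + t ≤ # U
      saves' = ≤-trans (+-monoʳ-≤ (# S★) t≤#Dropped) (≤-reflexive (sym #U≡))

    #Kept≤#Col : # Kept ≤ # Col
    #Kept≤#Col = #-injection Kept Col colour
      (λ u Kept∋u → occurring pal u (-⊆ U v u (kept-⊆ u Kept∋u))) kept-injective

    #Kept≤#Col-cv : Unique U v → # Kept ≤ # (Col - colour v)
    #Kept≤#Col-cv unique = #-injection Kept (Col - colour v) colour maps kept-injective
      where
      maps : ∀ u → Kept u ≡ true → (Col - colour v) (colour u) ≡ true
      maps u Kept∋u = trans (-other Col (-member U U-v∋u ∘ unique u (-⊆ U v u U-v∋u)))
                            (occurring pal u (-⊆ U v u U-v∋u))
        where
        U-v∋u : (U - v) u ≡ true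
        U-v∋u = kept-⊆ u Kept∋u

  x≢v : ∀ {x v} → adj x v ≡ true → ¬ x ≡ v
  x≢v {x} x~v refl with () ← trans (sym x~v) (adj-irrefl x)

  room : ∀ {U t m} → thr (suc t) (suc m) ≤ E U → suc t + m < # U
  room {U} {t} {m} thr≤E = ≰⇒> too-small
    where
    too-small : ¬ # U ≤ suc t + m
    too-small #U≤ = <-irrefl refl (begin-strict
      # U C 2              <⟨ C2<thr (s≤s z≤n) (≤-trans #U≤ (≤-reflexive (sym (+-suc t m)))) ⟩
      thr (suc t) (suc m)  ≤⟨ thr≤E ⟩
      E U                  ≤⟨ E-≤ U ⟩
      # U C 2              ∎)
      where open ≤-Reasoning

  Claim : ℕ → Set
  Claim s = ∀ {U Col t x} → # U ≡ s → Palette U Col → U x ≡ true → t < # U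
            → thr t (# Col) ≤ E U → Solution U Col t x

  record Deletion (U : Pred n) (Col : Pred c) (w : Fin n) : Set where
    field
      remaining : Pred c
      palette   : Palette (U - w) remaining
      shrinks   : remaining ⊆ Col
      recovers  : ∀ a → Col a ≡ true → remaining a ≡ true ⊎ a ≡ colour w
  open Deletion

  delete : ∀ {U Col} w → Palette U Col → Deletion U Col w
  delete {U} {Col} w pal with repeated-or-unique U w
  ... | inj₁ repeated = record { remaining = Col ; palette = palette-keep pal repeated
                               ; shrinks = λ _ Col∋a → Col∋a ; recovers = λ _ → inj₁ }
  ... | inj₂ unique   = record { remaining = Col - colour w ; palette = palette-drop pal unique
                               ; shrinks = -⊆ Col (colour w) ; recovers = λ _ → -recover Col (colour w) }

  -- Case 1: x has no neighbour in U.  Delete x, solve for U - x from an arbitrary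
  -- vertex, and put x back.
  isolated : ∀ {s} → Claim s → ∀ {U Col t x} → # U ≡ suc s → Palette U Col → U x ≡ true
    → suc t < # U → thr (suc t) (# Col) ≤ E U
    → ¬ (∃ λ u → U u ≡ true × adj x u ≡ true) → Solution U Col (suc t) x
  isolated IH {U} {Col} {t} {x} #U≡ pal Ux t<#U thr≤E no-neighbour =
    add-vertex solution Ux (recovers del) (inj₁ refl)
    where
    del : Deletion U Col x
    del = delete x pal
    deg≡0 : deg (U - x) x ≡ 0
    deg≡0 = sum-zero pointwise
      where
      pointwise : ∀ u → ⟦ (U - x) u ⟧ * ⟦ adj x u ⟧ ≡ 0
      pointwise u with (U - x) u in U-x∋u | adj x u in x~u
      ... | false | _     = refl
      ... | true  | false = refl
      ... | true  | true  = contradiction (u , -⊆ U x u U-x∋u , x~u) no-neighbour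
    E≡ : E U ≡ E (U - x)
    E≡ = trans (E-remove U x Ux) (trans (cong (E (U - x) +_) deg≡0) (+-identityʳ _))
    #Col≡ : # Col ≡ suc (# (Col - colour x))
    #Col≡ = #-remove Col (colour x) (occurring pal x Ux)
    thr≤E' : thr (suc t) (# (remaining del)) ≤ E (U - x)
    thr≤E' = ≤-trans (thr-mono-c (suc t) (#-mono (shrinks del))) (≤-trans thr≤E (≤-reflexive E≡))
    t<#U-x : suc t < # (U - x)
    t<#U-x = ≤-trans (s≤s (m≤m+n (suc t) _)) (room (subst (λ m → thr (suc t) m ≤ E (U - x)) #Col≡
                                                    (≤-trans thr≤E (≤-reflexive E≡))))
    x'-exists : ∃ λ x' → (U - x) x' ≡ true
    x'-exists = #-nonempty (U - x) (≤-trans (s≤s z≤n) t<#U-x)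
    solution : Solution (U - x) (remaining del) (suc t) (proj₁ x'-exists)
    solution = IH (#-remove-suc U x Ux #U≡) (palette del)
                  (proj₂ x'-exists) t<#U-x thr≤E'

  -- Case 2: x has a neighbour v whose colour occurs elsewhere in U.  If v has
  -- few neighbours, delete v (dominated by x) and save one vertex fewer in U - v;
  -- otherwise use the star around v.
  neighbour-repeated : ∀ {s} → Claim s → ∀ {U Col t x v} → # U ≡ suc s → Palette U Col → U x ≡ true
    → suc t < # U → thr (suc t) (# Col) ≤ E U → U v ≡ true → adj x v ≡ true → Repeated U v
    → Solution U Col (suc t) x
  neighbour-repeated IH {U} {Col} {t} {x} {v} #U≡ pal Ux t<#U thr≤E Uv x~v repeated
    with deg (U - v) v ≤? t + # Col
  ... | yes few = save-neighbour solution Uv x~v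
    where
    t<#U-v : t < # (U - v)
    t<#U-v = ≤-pred (subst (suc t <_) (#-remove U v Uv) t<#U)
    thr≤E' : thr t (# Col) ≤ E (U - v)
    thr≤E' = cancel-degree (thr-step-t t (#-member {U = Col} (occurring pal x Ux)))
                           (subst (thr (suc t) (# Col) ≤_) (E-remove U v Uv) thr≤E) few
    solution : Solution (U - v) Col t x
    solution = IH (#-remove-suc U v Uv #U≡) (palette-keep pal repeated) (trans (-other U (x≢v x~v)) Ux)
                  t<#U-v thr≤E'
  ... | no many = Star.star pal Ux Uv (suc t) (# Col) (Star.#Kept≤#Col pal Ux Uv) (≰⇒> many)

  -- If v
  -- has few neighbours, delete v together with its colour, save as many vertices
  -- in U - v, and put v back; otherwise use the star around v.
  neighbour-unique : ∀ {s} → Claim s → ∀ {U Col t x v} → # U ≡ suc s → Palette U Col → U x ≡ true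
    → suc t < # U → thr (suc t) (# Col) ≤ E U → U v ≡ true → adj x v ≡ true → Unique U v
    → Solution U Col (suc t) x
  neighbour-unique IH {U} {Col} {t} {x} {v} #U≡ pal Ux t<#U thr≤E Uv x~v unique
    with deg (U - v) v ≤? t + # (Col - colour v)
  ... | yes few = add-vertex solution Uv (λ _ → -recover Col (colour v)) (inj₂ refl)
    where
    Col' : Pred c
    Col' = Col - colour v
    #Col≡ : # Col ≡ suc (# Col')
    #Col≡ = #-remove Col (colour v) (occurring pal v Uv)
    Col'∋cx : Col' (colour x) ≡ true
    Col'∋cx = trans (-other Col (x≢v x~v ∘ unique x Ux)) (occurring pal x Ux)
    m : ℕ
    m = # (Col' - colour x)
    thr≤E-U : thr (suc t) (suc (suc m)) ≤ E U
    thr≤E-U = subst (λ d → thr (suc t) d ≤ E U) (trans #Col≡ (cong suc (#-remove Col' (colour x) Col'∋cx))) thr≤E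
    t<#U-v : suc t < # (U - v)
    t<#U-v = ≤-pred (begin-strict
      suc (suc t)        ≤⟨ s≤s (s≤s (m≤m+n t _)) ⟩
      suc (suc (t + m))  ≡⟨ cong suc (sym (+-suc t m)) ⟩
      suc t + suc m      <⟨ room thr≤E-U ⟩
      # U                ≡⟨ #-remove U v Uv ⟩
      suc (# (U - v))    ∎)
      where open ≤-Reasoning
    thr≤E' : thr (suc t) (# Col') ≤ E (U - v)
    thr≤E' = cancel-degree (thr-step-c t (# Col'))
               (subst₂ (λ d e → thr (suc t) d ≤ e) #Col≡ (E-remove U v Uv) thr≤E) few
    solution : Solution (U - v) Col' (suc t) x
    solution = IH (#-remove-suc U v Uv #U≡) (palette-drop pal unique) (trans (-other U (x≢v x~v)) Ux)
                  t<#U-v thr≤E'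
  ... | no many = Star.star pal Ux Uv (suc t) (# (Col - colour v)) (Star.#Kept≤#Col-cv pal Ux Uv unique)
                            (≰⇒> many)

  solve : ∀ s → Claim s
  solve zero {U} {x = x} #U≡0 pal Ux _ _ = contradiction (subst (1 ≤_) #U≡0 (#-member {U = U} Ux)) λ ()
  solve (suc s) {t = zero} _ pal Ux _ _ = everything pal Ux
  solve (suc s) {U} {t = suc t} {x} #U≡ pal Ux t<#U thr≤E
    with any? (λ u → (U u ≟ᵇ true) ×-dec (adj x u ≟ᵇ true))
  ... | no no-neighbour = isolated (solve s) #U≡ pal Ux t<#U thr≤E no-neighbour
  ... | yes (v , Uv , x~v) with repeated-or-unique U v
  ...   | inj₁ repeated = neighbour-repeated (solve s) #U≡ pal Ux t<#U thr≤E Uv x~v repeated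
  ...   | inj₂ unique   = neighbour-unique (solve s) #U≡ pal Ux t<#U thr≤E Uv x~v unique

∣tabulate∣ : ∀ {n} (S : Pred n) → ∣ Vec.tabulate S ∣ ≡ # S
∣tabulate∣ {zero} S = refl
∣tabulate∣ {suc n} S with S zero
... | true  = cong suc (∣tabulate∣ (S ∘ suc))
... | false = ∣tabulate∣ (S ∘ suc)

∣∣≡#lookup : ∀ {n} (S : Subset n) → ∣ S ∣ ≡ # (Vec.lookup S)
∣∣≡#lookup S = trans (cong ∣_∣ (sym (tabulate∘lookup S))) (∣tabulate∣ (Vec.lookup S))

∈tabulate : ∀ {n} (S : Pred n) {i} → S i ≡ true → i ∈ Vec.tabulate S
∈tabulate S {i} Si = lookup⇒[]= i (Vec.tabulate S) (trans (lookup∘tabulate S i) Si)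

at-most-n : ∀ {k n c} → 1 ≤ c → k + c < n + 2 → k ≤ n
at-most-n {k} {n} {c} c≥1 k+c<n+2 = +-cancelʳ-≤ 1 k n (≤-pred (begin-strict
  k + 1        ≤⟨ +-monoʳ-≤ k c≥1 ⟩
  k + c        <⟨ k+c<n+2 ⟩
  n + 2        ≡⟨ +-suc n 1 ⟩
  suc (n + 1)  ∎))
  where open ≤-Reasoning

upper-bound : ∀ (k n c : ℕ) → 0 < k → 1 ≤ c → k + c < n + 2
  → (G : VCGraph n c) → threshold n k c ≤ numEdges G → TropDomAtMost G k
upper-bound k n c k>0 c≥1 k+c<n+2 G thr≤m =
  Vec.tabulate (S sol) , (dominating , covering) , size
  where
  open Saving G
  open Solution
  all : ∀ {m} → Pred m
  all _ = true
  k≤n : k ≤ n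
  k≤n = at-most-n c≥1 k+c<n+2
  x : Fin n
  x = fromℕ< (≤-trans k>0 k≤n)
  palette : Palette all all
  palette = record { occurring = λ _ _ → refl ; realised = λ a _ → proj₁ (onto a) , refl , proj₂ (onto a) }
    where open VCGraph G using (onto)
  t<n : n ∸ k < # (all {n})
  t<n = subst (n ∸ k <_) (sym (#-full n)) (∸-monoʳ-< k>0 k≤n)
  thr≤E : thr (n ∸ k) (# (all {c})) ≤ EdgeCount.E (VCGraph.graph G) all
  thr≤E = subst₂ (λ c' m → thr (n ∸ k) c' ≤ m) (sym (#-full c)) (EdgeCount.edgeCount≡E (VCGraph.graph G)) thr≤m
  sol : Solution all all (n ∸ k) x
  sol = solve n (#-full n) palette refl t<n thr≤E
  dominating : Dominating G (Vec.tabulate (S sol))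
  dominating v with dominates sol v refl
  ... | inj₁ Sv = inj₁ (∈tabulate (S sol) Sv)
  ... | inj₂ (u , Su , u~v) = inj₂ (u , ∈tabulate (S sol) Su , u~v)
  covering : ∀ a → ∃ λ v → v ∈ Vec.tabulate (S sol) × VCGraph.colour G v ≡ a
  covering a with covers sol a refl
  ... | v , Sv , cv≡a = v , ∈tabulate (S sol) Sv , cv≡a
  size : ∣ Vec.tabulate (S sol) ∣ ≤ k
  size = subst (_≤ k) (sym (∣tabulate∣ (S sol))) (+-cancelʳ-≤ (n ∸ k) (# (S sol)) k
           (≤-trans (saves sol) (≤-reflexive (trans (#-full n) (sym (m+[n∸m]≡n k≤n))))))

below : ∀ {n} → ℕ → Pred n
below r i = toℕ i <ᵇ r

#below : ∀ n r → r ≤ n → # (below {n} r) ≡ r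
#below zero    zero    _         = refl
#below (suc n) zero    _         = sum-zero {suc n} {λ i → ⟦ below 0 i ⟧} λ _ → refl
#below (suc n) (suc r) (s≤s r≤n) = cong suc (#below n r r≤n)

adjoin-below : ∀ {n r} (r<n : r < n) → Adjoin (below r) (fromℕ< r<n) (below (suc r))
adjoin-below {n} {r} r<n = adjoin pointwise
  where
  value : ∀ {i} → i ≡ fromℕ< r<n → toℕ i ≡ r
  value refl = toℕ-fromℕ< r<n
  pointwise : ∀ i → ⟦ below (suc r) i ⟧ ≡ ⟦ below r i ⟧ + ⟦ ⁅ fromℕ< r<n ⁆ i ⟧
  pointwise i with <-cmp (toℕ i) r
  ... | tri< i<r i≢r _ rewrite <ᵇ-true i<r | <ᵇ-true (m<n⇒m<1+n i<r)
                             | dec-false (i ≟ fromℕ< r<n) (i≢r ∘ value) = refl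
  ... | tri≈ _ i≡r _ rewrite <ᵇ-false {toℕ i} {r} (<-irrefl i≡r) | <ᵇ-true (≤-reflexive (cong suc i≡r))
                           | dec-true (i ≟ fromℕ< r<n) (toℕ-injective (trans i≡r (sym (toℕ-fromℕ< r<n)))) = refl
  ... | tri> _ i≢r i>r rewrite <ᵇ-false (<-asym i>r) | <ᵇ-false {toℕ i} {suc r} (λ i<1+r → <-irrefl refl (<-≤-trans i>r (≤-pred i<1+r)))
                             | dec-false (i ≟ fromℕ< r<n) (i≢r ∘ value) = refl

-- With q = t + c', its vertices, named by their values m < n, are
--   m < c'       the coloured vertices, with the distinct colours 1 … c';
--   c' ≤ m < q   the set B of t vertices of colour 0;
--   m = q        the hub x, of colour 0, adjacent exactly to B;
--   m > q        isolated vertices of colour 0;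
-- and all vertices below q form a clique.
module Extremal (n c' t : ℕ) (q<n : t + c' < n) where

  q : ℕ
  q = t + c'

  inClique isHub inB : ℕ → Bool
  inClique m = m <ᵇ q
  isHub    m = m ≡ᵇ q
  inB      m = not (m <ᵇ c') ∧ (m <ᵇ q)

  link : ℕ → ℕ → Bool
  link a b = not (a ≡ᵇ b) ∧ ((inClique a ∧ inClique b) ∨ ((isHub a ∧ inB b) ∨ (isHub b ∧ inB a)))

  link-sym : ∀ a b → link a b ≡ link b a
  link-sym a b rewrite ≡ᵇ-sym a b | ∧-comm (inClique a) (inClique b) | ∨-comm (isHub a ∧ inB b) (isHub b ∧ inB a) = refl

  link-irrefl : ∀ a → link a a ≡ false
  link-irrefl a rewrite ≡ᵇ-true {a} refl = refl

  graph : Graph n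
  graph = record { adj = λ i j → link (toℕ i) (toℕ j)
                 ; sym = λ i j → link-sym (toℕ i) (toℕ j) ; irrefl = λ i → link-irrefl (toℕ i) }

  paint : ∀ {m} → Dec (m < c') → Fin (suc c')
  paint (yes m<c') = suc (fromℕ< m<c')
  paint (no _)     = zero

  paint-injective : ∀ {m m'} (d : Dec (m < c')) (d' : Dec (m' < c')) → m < c' → paint d' ≡ paint d → m' ≡ m
  paint-injective (yes m<c') (yes m'<c') _ eq =
    trans (sym (toℕ-fromℕ< m'<c')) (trans (cong toℕ (Fin-suc-injective eq)) (toℕ-fromℕ< m<c'))
  paint-injective (no m≮c') _ m<c' _ = contradiction m<c' m≮c'
  paint-injective (yes _) (no _) _ ()

  colourOf : Fin n → Fin (suc c')
  colourOf i = paint (toℕ i <? c')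

  c'≤q : c' ≤ q
  c'≤q = m≤n+m c' t

  x : Fin n
  x = fromℕ< q<n

  painter : Fin (suc c') → Fin n
  painter zero    = x
  painter (suc b) = fromℕ< (<-≤-trans (toℕ<n b) (≤-trans c'≤q (<⇒≤ q<n)))

  painter-colour : ∀ a → colourOf (painter a) ≡ a
  painter-colour zero with toℕ x <? c'
  ... | yes x<c' = contradiction (≤-trans x<c' (subst (c' ≤_) (sym (toℕ-fromℕ< q<n)) c'≤q)) (<-irrefl refl)
  ... | no _     = refl
  painter-colour (suc b) with toℕ (painter (suc b)) <? c'
  ... | yes p<c' = cong suc (toℕ-injective (trans (toℕ-fromℕ< p<c') (toℕ-fromℕ< _)))
  ... | no p≮c'  = contradiction (subst (_< c') (sym (toℕ-fromℕ< _)) (toℕ<n b)) p≮c'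

  G : VCGraph n (suc c')
  G = record { graph = graph ; colour = colourOf ; onto = λ a → painter a , painter-colour a }

  open EdgeCount graph

  inB⇒<q : ∀ {m} → inB m ≡ true → m < q
  inB⇒<q {m} inB-m with m <ᵇ q in m<ᵇq
  ... | true = <ᵇ⇒< m q (subst T (sym m<ᵇq) tt)
  ... | false rewrite ∧-zeroʳ (not (m <ᵇ c')) with () ← inB-m

  link-clique : ∀ {a b} → a < q → b < q → ¬ a ≡ b → link a b ≡ true
  link-clique a<q b<q a≢b rewrite ≡ᵇ-false a≢b | <ᵇ-true a<q | <ᵇ-true b<q = refl

  link-hub : ∀ b → link b q ≡ inB b
  link-hub b with b ≟ℕ q
  ... | yes refl rewrite ≡ᵇ-true {q} refl | <ᵇ-false {q} {q} (<-irrefl refl) = sym (∧-zeroʳ (not (q <ᵇ c')))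
  ... | no b≢q rewrite ≡ᵇ-false b≢q | ≡ᵇ-true {q} refl | <ᵇ-false {q} {q} (<-irrefl refl)
                     | ∧-zeroʳ (b <ᵇ q) = refl

  link-isolated : ∀ {a} b → q < a → link a b ≡ false
  link-isolated {a} b q<a rewrite <ᵇ-false (<-asym q<a) | ≡ᵇ-false {a} {q} (λ a≡q → <-irrefl (sym a≡q) q<a)
                                | ∧-zeroʳ (not (a <ᵇ c')) | ∧-zeroʳ (b ≡ᵇ q) = ∧-zeroʳ (not (a ≡ᵇ b))

  B : Pred n
  B i = inB (toℕ i)

  #B : # B ≡ t
  #B = +-cancelʳ-≡ c' (# B) t (begin
    # B + c'                              ≡⟨ +-comm (# B) c' ⟩
    c' + # B                              ≡⟨ cong (_+ # B) (sym (#below n c' (≤-trans c'≤q (<⇒≤ q<n)))) ⟩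
    # (below {n} c') + # B                ≡⟨ sym (∑-distrib-+ (λ i → ⟦ below c' i ⟧) (λ i → ⟦ B i ⟧)) ⟩
    sum (λ i → ⟦ below c' i ⟧ + ⟦ B i ⟧)  ≡⟨ sum-cong-≗ pointwise ⟩
    # (below {n} q)                       ≡⟨ #below n q (<⇒≤ q<n) ⟩
    q                                     ∎)
    where
    open ≡-Reasoning
    pointwise : ∀ i → ⟦ below c' i ⟧ + ⟦ B i ⟧ ≡ ⟦ below q i ⟧
    pointwise i with toℕ i <? c'
    ... | yes i<c' rewrite <ᵇ-true i<c' | <ᵇ-true (<-≤-trans i<c' c'≤q) = refl
    ... | no i≮c'  rewrite <ᵇ-false i≮c' = refl

  deg-clique : ∀ {r} (r<n : r < n) → r < q → deg (below r) (fromℕ< r<n) ≡ r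
  deg-clique {r} r<n r<q = trans (sum-cong-≗ pointwise) (#below n r (<⇒≤ r<n))
    where
    pointwise : ∀ (j : Fin n) → ⟦ below r j ⟧ * ⟦ link (toℕ (fromℕ< r<n)) (toℕ j) ⟧ ≡ ⟦ below r j ⟧
    pointwise j rewrite toℕ-fromℕ< r<n with toℕ j <? r
    ... | yes j<r rewrite <ᵇ-true j<r | link-clique r<q (<-trans j<r r<q) (λ r≡j → <-irrefl (sym r≡j) j<r) = refl
    ... | no j≮r  rewrite <ᵇ-false j≮r = refl

  deg-hub : (q<n' : q < n) → deg (below q) (fromℕ< q<n') ≡ t
  deg-hub q<n' = trans (sum-cong-≗ pointwise) #B
    where
    pointwise : ∀ (j : Fin n) → ⟦ below q j ⟧ * ⟦ link (toℕ (fromℕ< q<n')) (toℕ j) ⟧ ≡ ⟦ B j ⟧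
    pointwise j rewrite toℕ-fromℕ< q<n' | link-sym q (toℕ j) | link-hub (toℕ j) with inB (toℕ j) in inB-j
    ... | true  rewrite <ᵇ-true (inB⇒<q inB-j) = refl
    ... | false = *-zeroʳ ⟦ below q j ⟧

  deg-isolated : ∀ {r} (r<n : r < n) → q < r → deg (below r) (fromℕ< r<n) ≡ 0
  deg-isolated {r} r<n q<r = sum-zero pointwise
    where
    pointwise : ∀ (j : Fin n) → ⟦ below r j ⟧ * ⟦ link (toℕ (fromℕ< r<n)) (toℕ j) ⟧ ≡ 0
    pointwise j rewrite toℕ-fromℕ< r<n | link-isolated (toℕ j) q<r = *-zeroʳ ⟦ below {n} r j ⟧

  E-clique : ∀ {r} → r ≤ q → E (below r) ≡ r C 2
  E-clique {zero} _ = n≤0⇒n≡0 (subst (λ m → E (below 0) ≤ m C 2) (#below n 0 z≤n) (E-≤ (below 0)))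
  E-clique {suc r} r<q = begin
    E (below (suc r))                         ≡⟨ E-adjoin (adjoin-below r<n) ⟩
    E (below r) + deg (below r) (fromℕ< r<n)  ≡⟨ cong₂ _+_ (E-clique (<⇒≤ r<q)) (deg-clique r<n r<q) ⟩
    r C 2 + r                                 ≡⟨ sym (C2-suc r) ⟩
    suc r C 2                                 ∎
    where
    open ≡-Reasoning
    r<n : r < n
    r<n = <-trans r<q q<n

  E-beyond : ∀ {r} → q < r → r ≤ n → E (below r) ≡ q C 2 + t
  E-beyond {suc r} q<1+r r<n with m≤n⇒m<n∨m≡n (≤-pred q<1+r)
  ... | inj₂ refl = trans (E-adjoin (adjoin-below r<n)) (cong₂ _+_ (E-clique ≤-refl) (deg-hub r<n))
  ... | inj₁ q<r  = trans (E-adjoin (adjoin-below r<n))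
                          (trans (cong₂ _+_ (E-beyond q<r (<⇒≤ r<n)) (deg-isolated r<n q<r)) (+-identityʳ _))

  edges : numEdges G ≡ q C 2 + t
  edges = begin
    numEdges G                 ≡⟨ edgeCount≡E ⟩
    E (λ _ → true)             ≡⟨ between-cong all≗below all≗below ⟩
    E (below n)                ≡⟨ E-beyond q<n ≤-refl ⟩
    q C 2 + t                  ∎
    where
    open ≡-Reasoning
    all≗below : ∀ i → ⟦ true ⟧ ≡ ⟦ below n i ⟧
    all≗below i = cong ⟦_⟧ (sym (<ᵇ-true (toℕ<n i)))

  hub∉B : B x ≡ false
  hub∉B rewrite toℕ-fromℕ< q<n | <ᵇ-false {q} {q} (<-irrefl refl) = ∧-zeroʳ (not (q <ᵇ c'))

  painter∉B : ∀ a → B (painter a) ≡ false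
  painter∉B zero    = hub∉B
  painter∉B (suc b) rewrite toℕ-fromℕ< (<-≤-trans (toℕ<n b) (≤-trans c'≤q (<⇒≤ q<n)))
                          | <ᵇ-true (toℕ<n b) = refl

  hub-dominates : ∀ v → B v ≡ true → link (toℕ x) (toℕ v) ≡ true
  hub-dominates v B-v rewrite toℕ-fromℕ< q<n = trans (link-sym q (toℕ v)) (trans (link-hub (toℕ v)) B-v)

  S₀ : Pred n
  S₀ i = not (B i)

  #S₀ : # S₀ + t ≡ n
  #S₀ = trans (cong (# S₀ +_) (sym #B)) (#-complement B)

  S₀-tropical : TropicalDominating G (Vec.tabulate S₀)
  S₀-tropical = dominating , covering
    where
    dominating : Dominating G (Vec.tabulate S₀)
    dominating v = by-B (B v) refl
      where
      by-B : ∀ b → B v ≡ b → v ∈ Vec.tabulate S₀ ⊎ ∃ λ u → u ∈ Vec.tabulate S₀ × link (toℕ u) (toℕ v) ≡ true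
      by-B false B-v = inj₁ (∈tabulate S₀ (cong not B-v))
      by-B true  B-v = inj₂ (x , ∈tabulate S₀ (cong not hub∉B) , hub-dominates v B-v)
    covering : ∀ a → ∃ λ v → v ∈ Vec.tabulate S₀ × colourOf v ≡ a
    covering a = painter a , ∈tabulate S₀ (cong not (painter∉B a)) , painter-colour a

  Forced : Pred n
  Forced i = not ((B ∪⁅ x ⁆) i)

  #Forced : suc (# Forced) + t ≡ n
  #Forced = begin
    suc (# Forced) + t         ≡⟨ sym (+-suc (# Forced) t) ⟩
    # Forced + suc t           ≡⟨ cong (λ m → # Forced + suc m) (sym #B) ⟩
    # Forced + suc (# B)       ≡⟨ cong (# Forced +_) (sym (#-adjoin (adjoin-insert B x hub∉B))) ⟩
    # Forced + # (B ∪⁅ x ⁆)    ≡⟨ #-complement (B ∪⁅ x ⁆) ⟩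
    n                          ∎
    where open ≡-Reasoning

  forced-kind : ∀ i → Forced i ≡ true → toℕ i < c' ⊎ q < toℕ i
  forced-kind i Forced-i with toℕ i <? c'
  ... | yes i<c' = inj₁ i<c'
  ... | no i≮c' with toℕ i <? q
  ...   | yes i<q rewrite <ᵇ-false i≮c' | <ᵇ-true i<q with () ← Forced-i
  ...   | no i≮q with toℕ i ≟ℕ q
  ...     | no i≢q  = inj₂ (≤∧≢⇒< (≮⇒≥ i≮q) (i≢q ∘ sym))
  ...     | yes i≡q rewrite dec-true (i ≟ x) (toℕ-injective (trans i≡q (sym (toℕ-fromℕ< q<n))))
                          | ∨-zeroʳ (B i) with () ← Forced-i

  module _ (S : Subset n) (tropical : TropicalDominating G S) where

    -- A uniquely coloured vertex is the only way to meet its colour, and an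
    -- isolated vertex can only dominate itself.
    forced : Forced ⊆ Vec.lookup S
    forced i Forced-i with forced-kind i Forced-i
    ... | inj₁ i<c' with proj₂ tropical (colourOf i)
    ...   | s , s∈S , cs≡ci = subst (λ z → Vec.lookup S z ≡ true)
              (toℕ-injective (paint-injective (toℕ i <? c') (toℕ s <? c') i<c' cs≡ci)) ([]=⇒lookup s∈S)
    forced i Forced-i | inj₂ q<i with proj₁ tropical i
    ...   | inj₁ i∈S = []=⇒lookup i∈S
    ...   | inj₂ (u , _ , u~i) with () ← trans (sym u~i) (trans (link-sym (toℕ u) (toℕ i)) (link-isolated (toℕ u) q<i))

    dominator : ∃ λ z → Vec.lookup S z ≡ true × Forced z ≡ false
    dominator with proj₁ tropical x
    ... | inj₁ x∈S = x , []=⇒lookup x∈S , cong not (∪⁅⁆-self B x)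
    ... | inj₂ (u , u∈S , u~x) = u , []=⇒lookup u∈S , cong not (∪⁅⁆-⊇ B x u u∈B)
      where
      u∈B : B u ≡ true
      u∈B = trans (sym (link-hub (toℕ u))) (subst (λ m → link (toℕ u) m ≡ true) (toℕ-fromℕ< q<n) u~x)

    lower-bound : suc (# Forced) ≤ ∣ S ∣
    lower-bound with dominator
    ... | z , z∈S , Forced-z = begin
      suc (# Forced)          ≡⟨ sym (#-adjoin (adjoin-insert Forced z Forced-z)) ⟩
      # (Forced ∪⁅ z ⁆)       ≤⟨ #-mono Forced+z⊆S ⟩
      # (Vec.lookup S)        ≡⟨ sym (∣∣≡#lookup S) ⟩
      ∣ S ∣                   ∎
      where
      open ≤-Reasoning
      Forced+z⊆S : (Forced ∪⁅ z ⁆) ⊆ Vec.lookup S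
      Forced+z⊆S i Forced+z-i with Forced i in Forced-i | i ≟ z
      ... | true  | _        = forced i Forced-i
      ... | false | yes refl = z∈S

extremal : ∀ (k n c : ℕ) → 0 < k → 1 ≤ c → c ≤ k → k + c < n + 2
  → Σ (VCGraph n c) λ G → numEdges G ≡ threshold n k c × TropDomNumberIs G k
extremal k n (suc c') _ c≥1 c≤k k+c<n+2 =
  G , edges≡ , (Vec.tabulate S₀ , S₀-tropical , size) , minimal
  where
  k≤n : k ≤ n
  k≤n = at-most-n c≥1 k+c<n+2
  k+t≡n : k + (n ∸ k) ≡ n
  k+t≡n = m+[n∸m]≡n k≤n
  q<n : n ∸ k + c' < n
  q<n = subst (n ∸ k + c' <_) (trans (+-comm (n ∸ k) k) k+t≡n) (+-monoʳ-< (n ∸ k) c≤k)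
  open Extremal n c' (n ∸ k) q<n
  edges≡ : numEdges G ≡ threshold n k (suc c')
  edges≡ = trans edges (cong (λ m → (m ∸ 1) C 2 + (n ∸ k)) (sym (+-suc (n ∸ k) c')))
  size : ∣ Vec.tabulate S₀ ∣ ≡ k
  size = trans (∣tabulate∣ S₀) (+-cancelʳ-≡ (n ∸ k) (# S₀) k (trans #S₀ (sym k+t≡n)))
  minimal : ∀ S → TropicalDominating G S → k ≤ ∣ S ∣
  minimal S tropical = subst (_≤ ∣ S ∣) (+-cancelʳ-≡ (n ∸ k) (suc (# Forced)) k (trans #Forced (sym k+t≡n)))
                             (lower-bound S tropical)

mainTheorem4 : (∀ (k n c : ℕ) → 0 < k → 1 ≤ c → k + c < n + 2
                 → (G : VCGraph n c) → threshold n k c ≤ numEdges G → TropDomAtMost G k)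
               × (∀ (k n c : ℕ) → 0 < k → 1 ≤ c → c ≤ k → k + c < n + 2
                 → Σ (VCGraph n c) λ G → numEdges G ≡ threshold n k c × TropDomNumberIs G k)
mainTheorem4 = upper-bound , extremal
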